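{- For every fixed integer $q \geq 2$, the sequence $\{|F(i)|\}_{i=0}^{\infty}$ is strictly decreasing, where \[ F(i) = \frac{(-1)^i q^{1-2^{i+1}}}{\prod_{k=0}^{i} \left(1 - q^{1-2^{k+1}}\right)}. \] -}

module Defs where

open import Data.Nat as ℕ using (ℕ; zero; suc; _∸_)
open import Data.Integer using (+_)
open import Data.Rational using (ℚ; 0ℚ; 1ℚ; _*_; _-_; -_; _÷_; _/_; _≟_; ≢-nonZero)
open import Relation.Nullary using (yes; no)

_^ℚ_ : ℚ → ℕ → ℚ
x ^ℚ zero  = 1ℚ
x ^ℚ suc n = x * (x ^ℚ n)

-- total division on ℚ: p / q when q ≠ 0 (convention 0 when q = 0; never used here)
_÷₀_ : ℚ → ℚ → ℚ
p ÷₀ q with q ≟ 0ℚ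
... | yes _  = 0ℚ
... | no q≢0 = _÷_ p q {{≢-nonZero q≢0}}

-- q ^ (1 - 2^(k+1)) = (1/q) ^ (2^(k+1) - 1), for q ≥ 1
qpow : (q : ℕ) → .{{ℕ.NonZero q}} → ℕ → ℚ
qpow q k = ((+ 1) / q) ^ℚ ((2 ℕ.^ (suc k)) ∸ 1)

denom : (q : ℕ) → .{{ℕ.NonZero q}} → ℕ → ℚ
denom q zero    = 1ℚ - qpow q 0
denom q (suc i) = denom q i * (1ℚ - qpow q (suc i))

F : (q : ℕ) → .{{ℕ.NonZero q}} → ℕ → ℚ
F q i = (((- 1ℚ) ^ℚ i) * qpow q i) ÷₀ denom q i

-- Write t = 1/q, aᵢ = qpow q i = t^(2^(i+1) - 1) and Dᵢ = denom q i, so that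
-- |F(i)| = aᵢ / Dᵢ.  Two structural facts drive the proof:
--   * a_{i+1} = (t·aᵢ)·aᵢ, because 2^(i+2) - 1 = 1 + 2(2^(i+1) - 1);
--   * D_{i+1} = Dᵢ·(1 - a_{i+1}), by definition of the product.
-- Since t ≤ ½, every aᵢ lies in the interval (0, ½], which is closed under
-- multiplication; hence all factors 1 - aₖ, and so all Dᵢ, are positive.
-- The claim |F(i+1)| < |F(i)| becomes a_{i+1} / (Dᵢ (1 - a_{i+1})) < aᵢ / Dᵢ,
-- i.e. after clearing the positive denominator, a_{i+1} < aᵢ (1 - a_{i+1}).
-- With x = t·aᵢ this is x·a < a·(1 - x·a), which holds for all x, a ∈ (0, ½]
-- because a(1 - xa) - xa = a(1 - x - xa) and x + xa ≤ ½ + ¼ < 1.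

module Submission where

open import Defs
open import Data.Nat as ℕ using (ℕ; suc; zero; _≤_; s≤s; z≤n)
import Data.Nat.Properties as ℕ
open import Data.Nat.Coprimality using (1-coprimeTo)
open import Data.Integer using (+_; +<+; +≤+)
open import Data.Rational
  using (ℚ; 0ℚ; 1ℚ; ½; _<_; ∣_∣; _*_; _+_; _-_; -_; *<*; *≤*; _<?_; _≤?_; _≟_; ≢-nonZero; positive; nonNegative)
import Data.Rational as ℚ
open import Data.Rational.Properties
open import Data.Rational.Solver using (module +-*-Solver)
open import Data.Product using (_×_; _,_; proj₁)
open import Data.Empty using (⊥-elim)
open import Relation.Nullary using (yes; no)
open import Relation.Nullary.Decidable using (toWitness)
open import Relation.Binary.PropositionalEquality

<⇒0<- : ∀ {p r} → p < r → 0ℚ < r - p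
<⇒0<- {p} {r} p<r = subst (_< r - p) (+-inverseʳ p) (+-monoˡ-< (- p) p<r)

*-pos : ∀ {x y} → 0ℚ < x → 0ℚ < y → 0ℚ < x * y
*-pos {x} {y} 0<x 0<y = positive⁻¹ _ {{pos*pos⇒pos x {{positive 0<x}} y {{positive 0<y}}}}

*-mono-≤-nonNeg : ∀ {x x′ y y′} → 0ℚ ℚ.≤ x → x ℚ.≤ x′ → 0ℚ ℚ.≤ y → y ℚ.≤ y′ → x * y ℚ.≤ x′ * y′
*-mono-≤-nonNeg {x} {x′} {y} {y′} 0≤x x≤x′ 0≤y y≤y′ =
  ≤-trans (*-monoˡ-≤-nonNeg x {{nonNegative 0≤x}} y≤y′)
          (*-monoʳ-≤-nonNeg y′ {{nonNegative (≤-trans 0≤y y≤y′)}} x≤x′)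

^ℚ-+ : ∀ x m n → x ^ℚ (m ℕ.+ n) ≡ x ^ℚ m * x ^ℚ n
^ℚ-+ x zero    n = sym (*-identityˡ _)
^ℚ-+ x (suc m) n = trans (cong (x *_) (^ℚ-+ x m n)) (sym (*-assoc x _ _))

-- The exponents 2^(k+1) - 1 satisfy eₖ₊₁ = 1 + 2eₖ; stated for any positive s.
double-pred : ∀ s → 0 ℕ.< s → 2 ℕ.* s ℕ.∸ 1 ≡ suc ((s ℕ.∸ 1) ℕ.+ (s ℕ.∸ 1))
double-pred (suc r) _ = trans (cong (r ℕ.+_) (ℕ.+-identityʳ (suc r))) (ℕ.+-suc r r)

qpow-suc : ∀ q .{{_ : ℕ.NonZero q}} i →
           qpow q (suc i) ≡ ((+ 1 ℚ./ q) * qpow q i) * qpow q i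
qpow-suc q i = begin
  t ^ℚ (2 ℕ.* s ℕ.∸ 1)                 ≡⟨ cong (t ^ℚ_) (double-pred s (ℕ.m^n>0 2 (suc i))) ⟩
  t * t ^ℚ ((s ℕ.∸ 1) ℕ.+ (s ℕ.∸ 1))   ≡⟨ cong (t *_) (^ℚ-+ t (s ℕ.∸ 1) (s ℕ.∸ 1)) ⟩
  t * (qpow q i * qpow q i)            ≡⟨ sym (*-assoc t _ _) ⟩
  (t * qpow q i) * qpow q i            ∎
  where
  open ≡-Reasoning
  t : ℚ
  t = + 1 ℚ./ q
  s : ℕ
  s = 2 ℕ.^ suc i

InHalf : ℚ → Set
InHalf x = (0ℚ < x) × (x ℚ.≤ ½)

InHalf-* : ∀ {x y} → InHalf x → InHalf y → InHalf (x * y)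
InHalf-* (0<x , x≤½) (0<y , y≤½) =
  *-pos 0<x 0<y ,
  ≤-trans (*-mono-≤-nonNeg (<⇒≤ 0<x) x≤½ (<⇒≤ 0<y) y≤½) ¼≤½
  where
  ¼≤½ : ½ * ½ ℚ.≤ ½
  ¼≤½ = toWitness {a? = ½ * ½ ≤? ½} _

InHalf⇒0<1- : ∀ {x} → InHalf x → 0ℚ < 1ℚ - x
InHalf⇒0<1- (_ , x≤½) = <⇒0<- (≤-<-trans x≤½ (toWitness {a? = ½ <? 1ℚ} _))

InHalf-1/q : ∀ q .{{_ : ℕ.NonZero q}} → 2 ≤ q → InHalf (+ 1 ℚ./ q)
InHalf-1/q (suc (suc k)) (s≤s (s≤s _)) rewrite normalize-coprime {1} {suc k} (1-coprimeTo _) =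
  *<* (+<+ (s≤s z≤n)) , *≤* (+≤+ (s≤s (s≤s z≤n)))

InHalf-qpow : ∀ q .{{_ : ℕ.NonZero q}} → 2 ≤ q → ∀ i → InHalf (qpow q i)
InHalf-qpow q 2≤q zero =
  subst InHalf (sym (*-identityʳ _)) (InHalf-1/q q 2≤q)
InHalf-qpow q 2≤q (suc i) rewrite qpow-suc q i =
  InHalf-* (InHalf-* (InHalf-1/q q 2≤q) (InHalf-qpow q 2≤q i)) (InHalf-qpow q 2≤q i)

shrink-identity : ∀ x a → a * (1ℚ - x * a) ≡ x * a + a * (1ℚ - (x + x * a))
shrink-identity = solve 2 (λ x a → a :* (con 1ℚ :- x :* a) := x :* a :+ a :* (con 1ℚ :- (x :+ x :* a))) refl
  where open +-*-Solver

shrink : ∀ {x a} → 0ℚ < a → x + x * a < 1ℚ → x * a < a * (1ℚ - x * a)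
shrink {x} {a} 0<a small =
  subst (x * a <_) (sym (shrink-identity x a))
        (subst (_< x * a + gap) (+-identityʳ (x * a)) (+-monoʳ-< (x * a) (*-pos 0<a (<⇒0<- small))))
  where
  gap : ℚ
  gap = a * (1ℚ - (x + x * a))

shrink-InHalf : ∀ {x a} → InHalf x → InHalf a → x * a < a * (1ℚ - x * a)
shrink-InHalf {x} {a} (0<x , x≤½) (0<a , a≤½) = shrink {x} 0<a
  (≤-<-trans (+-mono-≤ x≤½ (*-mono-≤-nonNeg (<⇒≤ 0<x) x≤½ (<⇒≤ 0<a) a≤½)) (toWitness {a? = ½ + ½ * ½ <? 1ℚ} _))

÷₀-cancel : ∀ p {d} → 0ℚ < d → (p ÷₀ d) * d ≡ p
÷₀-cancel p {d} 0<d with d ≟ 0ℚ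
... | yes d≡0 = ⊥-elim (<-irrefl (sym d≡0) 0<d)
... | no  d≢0 = trans (*-assoc p _ d) (trans (cong (p *_) (*-inverseˡ d {{≢-nonZero d≢0}})) (*-identityʳ p))

∣÷₀∣ : ∀ p {d} → 0ℚ < d → ∣ p ÷₀ d ∣ ≡ ∣ p ∣ ÷₀ d
∣÷₀∣ p {d} 0<d with d ≟ 0ℚ
... | yes d≡0 = ⊥-elim (<-irrefl (sym d≡0) 0<d)
... | no  d≢0 = trans (∣p*q∣≡∣p∣*∣q∣ p _)
                      (cong (∣ p ∣ *_) (0≤p⇒∣p∣≡p (<⇒≤ (positive⁻¹ _ {{1/pos⇒pos d {{positive 0<d}}}}))))

÷₀-step : ∀ {a b d e} → 0ℚ < d → 0ℚ < e → b < a * e → b ÷₀ (d * e) < a ÷₀ d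
÷₀-step {a} {b} {d} {e} 0<d 0<e b<ae =
  *-cancelʳ-<-nonNeg (d * e) {{nonNegative (<⇒≤ 0<de)}}
    (subst₂ _<_ (sym (÷₀-cancel b 0<de)) (sym cleared) b<ae)
  where
  open ≡-Reasoning
  0<de : 0ℚ < d * e
  0<de = *-pos 0<d 0<e
  cleared : (a ÷₀ d) * (d * e) ≡ a * e
  cleared = begin
    (a ÷₀ d) * (d * e)   ≡⟨ sym (*-assoc (a ÷₀ d) d e) ⟩
    ((a ÷₀ d) * d) * e   ≡⟨ cong (_* e) (÷₀-cancel a 0<d) ⟩
    a * e                ∎

∣-1^i∣ : ∀ i → ∣ (- 1ℚ) ^ℚ i ∣ ≡ 1ℚ
∣-1^i∣ zero    = refl
∣-1^i∣ (suc i) = trans (∣p*q∣≡∣p∣*∣q∣ (- 1ℚ) ((- 1ℚ) ^ℚ i)) (cong (1ℚ *_) (∣-1^i∣ i))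

denom-pos : ∀ q .{{_ : ℕ.NonZero q}} → 2 ≤ q → ∀ i → 0ℚ < denom q i
denom-pos q 2≤q zero    = InHalf⇒0<1- (InHalf-qpow q 2≤q 0)
denom-pos q 2≤q (suc i) = *-pos (denom-pos q 2≤q i) (InHalf⇒0<1- (InHalf-qpow q 2≤q (suc i)))

∣F∣ : ∀ q .{{_ : ℕ.NonZero q}} → 2 ≤ q → ∀ i → ∣ F q i ∣ ≡ qpow q i ÷₀ denom q i
∣F∣ q 2≤q i = begin
  ∣ ((- 1ℚ) ^ℚ i * qpow q i) ÷₀ denom q i ∣     ≡⟨ ∣÷₀∣ _ (denom-pos q 2≤q i) ⟩
  ∣ (- 1ℚ) ^ℚ i * qpow q i ∣ ÷₀ denom q i       ≡⟨ cong (_÷₀ denom q i) (∣p*q∣≡∣p∣*∣q∣ ((- 1ℚ) ^ℚ i) (qpow q i)) ⟩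
  (∣ (- 1ℚ) ^ℚ i ∣ * ∣ qpow q i ∣) ÷₀ denom q i ≡⟨ cong₂ (λ s a → (s * a) ÷₀ denom q i) (∣-1^i∣ i) ∣aᵢ∣≡aᵢ ⟩
  (1ℚ * qpow q i) ÷₀ denom q i                  ≡⟨ cong (_÷₀ denom q i) (*-identityˡ _) ⟩
  qpow q i ÷₀ denom q i                         ∎
  where
  open ≡-Reasoning
  ∣aᵢ∣≡aᵢ : ∣ qpow q i ∣ ≡ qpow q i
  ∣aᵢ∣≡aᵢ = 0≤p⇒∣p∣≡p (<⇒≤ (proj₁ (InHalf-qpow q 2≤q i)))

qpow-shrinks : ∀ q .{{_ : ℕ.NonZero q}} → 2 ≤ q → ∀ i → qpow q (suc i) < qpow q i * (1ℚ - qpow q (suc i))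
qpow-shrinks q 2≤q i rewrite qpow-suc q i =
  shrink-InHalf (InHalf-* (InHalf-1/q q 2≤q) (InHalf-qpow q 2≤q i)) (InHalf-qpow q 2≤q i)

lemmaA1 : (q : ℕ) → .{{_ : ℕ.NonZero q}} → 2 ≤ q → (i : ℕ) → ∣ F q (suc i) ∣ < ∣ F q i ∣
lemmaA1 q 2≤q i =
  subst₂ _<_ (sym (∣F∣ q 2≤q (suc i))) (sym (∣F∣ q 2≤q i))
    (÷₀-step (denom-pos q 2≤q i) (InHalf⇒0<1- (InHalf-qpow q 2≤q (suc i))) (qpow-shrinks q 2≤q i))
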